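{- Let $k\geq 2$ and $G\in S_{k,1}$. Then $\overline{G}\in S_{k(k-1),2(k-1)}$.
   Context: A set of sequences $Q$ consists of sequences of pairwise distinct items, each with a type. The sequence digraph $g(Q)$ has as vertex set the set of all types occurring in $Q$, and an arc $(u,v)$ iff $u\neq v$ and in some sequence an item of type $u$ occurs at a position strictly before an item of type $v$. $S_{k,\ell}$ is the class of all digraphs $g(Q)$ with $Q$ consisting of at most $k$ sequences and containing, summed over all sequences, at most $\ell$ items of each type. For $G=(V,A)$, $\overline{G}=(V,\{(u,v)\mid u\neq v,(u,v)\notin A\})$. -}

module Defs where

open import Data.Nat using (ℕ; _≤_; _<_)
open import Data.Fin using (Fin; toℕ; _≟_)
open import Data.List using (List; length; lookup; concat; filter)
open import Data.List.Membership.Propositional using (_∈_)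
open import Data.Product using (Σ; _×_; ∃-syntax)
open import Relation.Binary.PropositionalEquality using (_≡_; _≢_)
open import Relation.Nullary using (¬_)
open import Function.Bundles using (_⇔_)

Digraph : ℕ → Set₁
Digraph n = Fin n → Fin n → Set

-- A sequence is represented by the list of the types of its items
-- (items within a sequence are pairwise distinct, so each position is a
-- distinct item; only the types matter for g(Q) and for the counts).
SeqSet : ℕ → Set
SeqSet n = List (List (Fin n))

OccursBefore : ∀ {n} → List (Fin n) → Fin n → Fin n → Set
OccursBefore s u v =
  ∃[ i ] ∃[ j ] (toℕ {length s} i < toℕ j × lookup s i ≡ u × lookup s j ≡ v)

gArc : ∀ {n} → SeqSet n → Fin n → Fin n → Set
gArc Q u v = u ≢ v × ∃[ s ] (s ∈ Q × OccursBefore s u v)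

itemsOfType : ∀ {n} → SeqSet n → Fin n → ℕ
itemsOfType Q v = length (filter (_≟ v) (concat Q))

-- G = g(Q): the vertex set of g(Q) (the types occurring in Q) is all of
-- Fin n, and the arcs coincide.
IsSeqDigraph : ∀ {n} → SeqSet n → Digraph n → Set
IsSeqDigraph {n} Q G =
  ((v : Fin n) → ∃[ s ] (s ∈ Q × v ∈ s)) ×
  ((u v : Fin n) → G u v ⇔ gArc Q u v)

InS : ℕ → ℕ → ∀ {n} → Digraph n → Set
InS k ℓ {n} G = ∃[ Q ] (length Q ≤ k × ((v : Fin n) → itemsOfType Q v ≤ ℓ)
                         × IsSeqDigraph Q G)

complement : ∀ {n} → Digraph n → Digraph n
complement G u v = u ≢ v × ¬ G u v

-- Pad Q with empty sequences to a list P of exactly k "blocks"; for every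
-- ordered pair (a , b) of blocks at distinct positions of P take the sequence
-- reverse a ++ reverse b.  That gives k (k - 1) sequences, and each type lies
-- in exactly one block, which takes part in 2 (k - 1) of the ordered pairs.
-- In reverse a ++ reverse b a type u comes before v exactly when either u and
-- v lie in different blocks, or they lie in the same block with v before u;
-- since types are not repeated, these are precisely the non-arcs u ≠ v of G.
module Submission where

open import Defs
open import Data.Nat using (ℕ; _≤_; _*_; _∸_)
open import Data.Nat.Base using (zero; suc; _+_; z≤n; s≤s)
open import Data.Nat.Properties
  using (module ≤-Reasoning; ≤-trans; ≤-reflexive; <-irrefl; m≤m+n; m≤n+m; +-mono-≤; *-monoʳ-≤; *-identityʳ; m+[n∸m]≡n)
open import Data.Nat.Solver using (module +-*-Solver)
open import Data.Fin.Base as Fin using (Fin)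
open import Data.Fin.Properties using () renaming (_≟_ to _≟ᶠ_)
open import Data.List.Base using (List; []; _∷_; _++_; [_]; length; concat; filter; map; reverse; replicate)
open import Data.Nat.ListAction using (sum)
open import Data.Nat.ListAction.Properties using (sum-++)
open import Data.List.Properties
  using (length-++; length-map; length-replicate; filter-++; map-++; map-∘; map-cong; unfold-reverse; reverse-involutive)
open import Data.List.Relation.Unary.Any using (here; there; index)
open import Data.List.Relation.Unary.Any.Properties using (reverse⁺; reverse⁻; lookup-index)
open import Data.List.Membership.Propositional using (_∈_)
open import Data.List.Membership.Propositional.Properties using (∈-map⁺; ∈-map⁻; ∈-concat⁺′; ∈-++⁺ˡ; ∈-++⁺ʳ; ∈-++⁻; ∈-lookup)
open import Data.List.Relation.Binary.Permutation.Propositional.Properties using (↭-length; filter-↭; ↭-reverse)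
open import Data.Product using (_×_; ∃-syntax; _,_; proj₁; proj₂)
open import Data.Sum using (_⊎_; inj₁; inj₂)
open import Data.Empty using (⊥; ⊥-elim)
open import Function.Base using (_∘_)
open import Function.Bundles using (mk⇔; Equivalence)
open import Relation.Binary.Definitions using (DecidableEquality)
open import Relation.Binary.PropositionalEquality using (_≡_; _≢_; refl; sym; trans; cong; cong₂; subst; module ≡-Reasoning)
open import Relation.Nullary using (¬_; yes; no)


module _ {A : Set} where

  data Precedes : List A → A → A → Set where
    at-head : ∀ {u v xs} → v ∈ xs → Precedes (u ∷ xs) u v
    in-tail : ∀ {x u v xs} → Precedes xs u v → Precedes (x ∷ xs) u v

  precedes-∈ˡ : ∀ {s u v} → Precedes s u v → u ∈ s
  precedes-∈ˡ (at-head _) = here refl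
  precedes-∈ˡ (in-tail p) = there (precedes-∈ˡ p)

  precedes-∈ʳ : ∀ {s u v} → Precedes s u v → v ∈ s
  precedes-∈ʳ (at-head v∈) = there v∈
  precedes-∈ʳ (in-tail p) = there (precedes-∈ʳ p)

  precedes-++ˡ : ∀ {a u v} (b : List A) → Precedes a u v → Precedes (a ++ b) u v
  precedes-++ˡ b (at-head v∈) = at-head (∈-++⁺ˡ v∈)
  precedes-++ˡ b (in-tail p) = in-tail (precedes-++ˡ b p)

  precedes-across : ∀ {a b : List A} {u v} → u ∈ a → v ∈ b → Precedes (a ++ b) u v
  precedes-across {_ ∷ a} (here refl) v∈ = at-head (∈-++⁺ʳ a v∈)
  precedes-across (there u∈) v∈ = in-tail (precedes-across u∈ v∈)

  precedes-++⁻ : ∀ (a : List A) {b u v} → Precedes (a ++ b) u v →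
                 Precedes a u v ⊎ (u ∈ a × v ∈ b) ⊎ Precedes b u v
  precedes-++⁻ [] p = inj₂ (inj₂ p)
  precedes-++⁻ (_ ∷ a) (at-head v∈) with ∈-++⁻ a v∈
  ... | inj₁ v∈a = inj₁ (at-head v∈a)
  ... | inj₂ v∈b = inj₂ (inj₁ (here refl , v∈b))
  precedes-++⁻ (_ ∷ a) (in-tail p) with precedes-++⁻ a p
  ... | inj₁ q = inj₁ (in-tail q)
  ... | inj₂ (inj₁ (u∈ , v∈)) = inj₂ (inj₁ (there u∈ , v∈))
  ... | inj₂ (inj₂ q) = inj₂ (inj₂ q)

  precedes-reverse : ∀ (s : List A) {u v} → Precedes s v u → Precedes (reverse s) u v
  precedes-reverse (x ∷ xs) p = subst (λ t → Precedes t _ _) (sym (unfold-reverse x xs)) (reversed p)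
    where
    reversed : ∀ {u v} → Precedes (x ∷ xs) v u → Precedes (reverse xs ++ [ x ]) u v
    reversed (at-head u∈) = precedes-across (reverse⁺ u∈) (here refl)
    reversed (in-tail q) = precedes-++ˡ [ x ] (precedes-reverse xs q)

  precedes-reverse⁻ : ∀ (s : List A) {u v} → Precedes (reverse s) u v → Precedes s v u
  precedes-reverse⁻ s p = subst (λ t → Precedes t _ _) (reverse-involutive s) (precedes-reverse (reverse s) p)

  precedes-total : ∀ {s : List A} {u v} → u ∈ s → v ∈ s → u ≢ v → Precedes s u v ⊎ Precedes s v u
  precedes-total (here refl) (here refl) u≢v = ⊥-elim (u≢v refl)
  precedes-total (here refl) (there v∈) _ = inj₁ (at-head v∈)
  precedes-total (there u∈) (here refl) _ = inj₂ (at-head u∈)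
  precedes-total (there u∈) (there v∈) u≢v with precedes-total u∈ v∈ u≢v
  ... | inj₁ p = inj₁ (in-tail p)
  ... | inj₂ p = inj₂ (in-tail p)

  Arc : List (List A) → A → A → Set
  Arc Q u v = ∃[ s ] (s ∈ Q × Precedes s u v)

  Covered : List (List A) → A → Set
  Covered Q v = ∃[ s ] (s ∈ Q × v ∈ s)

  pairsWith : A → List A → List (A × A)
  pairsWith x [] = []
  pairsWith x (y ∷ ys) = (x , y) ∷ (y , x) ∷ pairsWith x ys

  orderedPairs : List A → List (A × A)
  orderedPairs [] = []
  orderedPairs (x ∷ xs) = pairsWith x xs ++ orderedPairs xs

  length-pairsWith : ∀ x (ys : List A) → length (pairsWith x ys) ≡ 2 * length ys
  length-pairsWith x [] = refl
  length-pairsWith x (y ∷ ys) = begin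
    suc (suc (length (pairsWith x ys))) ≡⟨ cong (suc ∘ suc) (length-pairsWith x ys) ⟩
    suc (suc (2 * length ys))           ≡⟨ solve 1 (λ m → con 2 :+ con 2 :* m := con 2 :* (con 1 :+ m)) refl (length ys) ⟩
    2 * suc (length ys)                 ∎
    where
    open ≡-Reasoning
    open +-*-Solver

  length-orderedPairs : ∀ (xs : List A) → length (orderedPairs xs) ≡ length xs * (length xs ∸ 1)
  length-orderedPairs [] = refl
  length-orderedPairs (x ∷ ys) = begin
    length (pairsWith x ys ++ orderedPairs ys)           ≡⟨ length-++ (pairsWith x ys) ⟩
    length (pairsWith x ys) + length (orderedPairs ys)   ≡⟨ cong₂ _+_ (length-pairsWith x ys) (length-orderedPairs ys) ⟩
    2 * length ys + length ys * (length ys ∸ 1)          ≡⟨ step (length ys) ⟩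
    suc (length ys) * length ys                          ∎
    where
    open ≡-Reasoning
    open +-*-Solver
    step : ∀ m → 2 * m + m * (m ∸ 1) ≡ suc m * m
    step zero = refl
    step (suc m) = solve 1 (λ m → con 2 :* (con 1 :+ m) :+ (con 1 :+ m) :* m := (con 2 :+ m) :* (con 1 :+ m)) refl m

  pairsWith-fst : ∀ {x y} {ys : List A} → y ∈ ys → (x , y) ∈ pairsWith x ys
  pairsWith-fst (here refl) = here refl
  pairsWith-fst (there y∈) = there (there (pairsWith-fst y∈))

  pairsWith-snd : ∀ {x y} {ys : List A} → y ∈ ys → (y , x) ∈ pairsWith x ys
  pairsWith-snd (here refl) = there (here refl)
  pairsWith-snd (there y∈) = there (there (pairsWith-snd y∈))

  pairsWith⁻ : ∀ {x a b} (ys : List A) → (a , b) ∈ pairsWith x ys → (a ≡ x × b ∈ ys) ⊎ (b ≡ x × a ∈ ys)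
  pairsWith⁻ (y ∷ ys) (here refl) = inj₁ (refl , here refl)
  pairsWith⁻ (y ∷ ys) (there (here refl)) = inj₂ (refl , here refl)
  pairsWith⁻ (y ∷ ys) (there (there p)) with pairsWith⁻ ys p
  ... | inj₁ (a≡x , b∈) = inj₁ (a≡x , there b∈)
  ... | inj₂ (b≡x , a∈) = inj₂ (b≡x , there a∈)

  orderedPairs-∷⁻ : ∀ {x a b} (xs : List A) → (a , b) ∈ orderedPairs (x ∷ xs) →
                    (a ≡ x × b ∈ xs) ⊎ (b ≡ x × a ∈ xs) ⊎ (a , b) ∈ orderedPairs xs
  orderedPairs-∷⁻ {x} xs p with ∈-++⁻ (pairsWith x xs) p
  ... | inj₂ q = inj₂ (inj₂ q)
  ... | inj₁ q with pairsWith⁻ xs q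
  ...   | inj₁ r = inj₁ r
  ...   | inj₂ r = inj₂ (inj₁ r)

  orderedPairs-∈ : ∀ {a b} (xs : List A) → (a , b) ∈ orderedPairs xs → a ∈ xs × b ∈ xs
  orderedPairs-∈ (x ∷ xs) p with orderedPairs-∷⁻ xs p
  ... | inj₁ (refl , b∈) = here refl , there b∈
  ... | inj₂ (inj₁ (refl , a∈)) = there a∈ , here refl
  ... | inj₂ (inj₂ q) = let a∈ , b∈ = orderedPairs-∈ xs q in there a∈ , there b∈

  orderedPairs⁺ : ∀ {x y} {xs : List A} → x ∈ xs → y ∈ xs → x ≡ y ⊎ (x , y) ∈ orderedPairs xs
  orderedPairs⁺ (here refl) (here refl) = inj₁ refl
  orderedPairs⁺ {xs = z ∷ zs} (here refl) (there y∈) = inj₂ (∈-++⁺ˡ (pairsWith-fst y∈))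
  orderedPairs⁺ {xs = z ∷ zs} (there x∈) (here refl) = inj₂ (∈-++⁺ˡ (pairsWith-snd x∈))
  orderedPairs⁺ {xs = z ∷ zs} (there x∈) (there y∈) with orderedPairs⁺ x∈ y∈
  ... | inj₁ x≡y = inj₁ x≡y
  ... | inj₂ p = inj₂ (∈-++⁺ʳ (pairsWith z zs) p)

  partner : ∀ {x} {xs : List A} → x ∈ xs → 2 ≤ length xs → ∃[ y ] ((x , y) ∈ orderedPairs xs)
  partner {xs = _ ∷ []} (here refl) (s≤s ())
  partner {xs = _ ∷ y ∷ _} (here refl) _ = y , here refl
  partner {xs = z ∷ zs} (there x∈) _ = z , ∈-++⁺ˡ (pairsWith-snd x∈)

  pairWeight : (A → ℕ) → A × A → ℕ
  pairWeight w (a , b) = w a + w b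

  sum-pairsWith : ∀ (w : A → ℕ) x ys →
                  sum (map (pairWeight w) (pairsWith x ys)) ≡ length ys * (2 * w x) + 2 * sum (map w ys)
  sum-pairsWith w x [] = refl
  sum-pairsWith w x (y ∷ ys) = begin
    (w x + w y) + ((w y + w x) + sum (map (pairWeight w) (pairsWith x ys)))
      ≡⟨ cong (λ t → (w x + w y) + ((w y + w x) + t)) (sum-pairsWith w x ys) ⟩
    (w x + w y) + ((w y + w x) + (length ys * (2 * w x) + 2 * sum (map w ys)))
      ≡⟨ solve 4 (λ a b m s → (a :+ b) :+ ((b :+ a) :+ (m :* (con 2 :* a) :+ con 2 :* s))
                           := (con 1 :+ m) :* (con 2 :* a) :+ con 2 :* (b :+ s))
               refl (w x) (w y) (length ys) (sum (map w ys)) ⟩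
    suc (length ys) * (2 * w x) + 2 * (w y + sum (map w ys)) ∎
    where
    open ≡-Reasoning
    open +-*-Solver

  -- every entry of xs takes part in 2 (length xs - 1) ordered pairs, so summing
  -- pair weights counts each entry's weight 2 (length xs - 1) times
  sum-orderedPairs : ∀ (w : A → ℕ) xs →
                     sum (map (pairWeight w) (orderedPairs xs)) ≡ 2 * (length xs ∸ 1) * sum (map w xs)
  sum-orderedPairs w [] = refl
  sum-orderedPairs w (x ∷ []) = refl
  sum-orderedPairs w (x ∷ ys@(y ∷ zs)) = begin
    sum (map (pairWeight w) (pairsWith x ys ++ orderedPairs ys))
      ≡⟨ cong sum (map-++ (pairWeight w) (pairsWith x ys) (orderedPairs ys)) ⟩
    sum (map (pairWeight w) (pairsWith x ys) ++ map (pairWeight w) (orderedPairs ys))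
      ≡⟨ sum-++ (map (pairWeight w) (pairsWith x ys)) _ ⟩
    sum (map (pairWeight w) (pairsWith x ys)) + sum (map (pairWeight w) (orderedPairs ys))
      ≡⟨ cong₂ _+_ (sum-pairsWith w x ys) (sum-orderedPairs w ys) ⟩
    suc (length zs) * (2 * w x) + 2 * sum (map w ys) + 2 * length zs * sum (map w ys)
      ≡⟨ solve 3 (λ m a s → (con 1 :+ m) :* (con 2 :* a) :+ con 2 :* s :+ con 2 :* m :* s
                         := con 2 :* (con 1 :+ m) :* (a :+ s))
               refl (length zs) (w x) (sum (map w ys)) ⟩
    2 * suc (length zs) * (w x + sum (map w ys)) ∎
    where
    open ≡-Reasoning
    open +-*-Solver

  unpad-∈ : ∀ (Q : List (List A)) m {s x} → s ∈ Q ++ replicate m [] → x ∈ s → s ∈ Q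
  unpad-∈ Q m s∈ x∈s with ∈-++⁻ Q s∈
  ... | inj₁ s∈Q = s∈Q
  ... | inj₂ s∈pad = ⊥-elim (no-items m s∈pad x∈s)
    where
    no-items : ∀ j {t y} → t ∈ replicate j [] → ¬ y ∈ t
    no-items (suc j) (here refl) ()
    no-items (suc j) (there t∈) = no-items j t∈

  concat-padding : ∀ (Q : List (List A)) m → concat (Q ++ replicate m []) ≡ concat Q
  concat-padding [] zero = refl
  concat-padding [] (suc m) = concat-padding [] m
  concat-padding (s ∷ Q) m = cong (s ++_) (concat-padding Q m)

  length-padding : ∀ (Q : List (List A)) {k} → length Q ≤ k → length (Q ++ replicate (k ∸ length Q) []) ≡ k
  length-padding Q {k} |Q|≤k = begin
    length (Q ++ replicate (k ∸ length Q) [])             ≡⟨ length-++ Q ⟩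
    length Q + length (replicate (k ∸ length Q) [])       ≡⟨ cong (length Q +_) (length-replicate (k ∸ length Q)) ⟩
    length Q + (k ∸ length Q)                             ≡⟨ m+[n∸m]≡n |Q|≤k ⟩
    k                                                     ∎
    where open ≡-Reasoning

module Occurrences {A : Set} (_≟_ : DecidableEquality A) where

  count : A → List A → ℕ
  count w xs = length (filter (_≟ w) xs)

  AtMostOnce : List A → Set
  AtMostOnce xs = ∀ w → count w xs ≤ 1

  count-++ : ∀ w xs ys → count w (xs ++ ys) ≡ count w xs + count w ys
  count-++ w xs ys = trans (cong length (filter-++ (_≟ w) xs ys)) (length-++ (filter (_≟ w) xs))

  count-reverse : ∀ w xs → count w (reverse xs) ≡ count w xs
  count-reverse w xs = ↭-length (filter-↭ (_≟ w) (↭-reverse xs))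

  count-concat : ∀ w xss → count w (concat xss) ≡ sum (map (count w) xss)
  count-concat w [] = refl
  count-concat w (xs ∷ xss) = trans (count-++ w xs (concat xss)) (cong (count w xs +_) (count-concat w xss))

  count-∈ : ∀ {w xs} → w ∈ xs → 1 ≤ count w xs
  count-∈ {w} (here refl) with w ≟ w
  ... | yes _ = s≤s z≤n
  ... | no w≢w = ⊥-elim (w≢w refl)
  count-∈ {w} (there {x} w∈) with x ≟ w
  ... | yes _ = s≤s z≤n
  ... | no _ = count-∈ w∈

  twice-++ : ∀ {w} xs {ys} → w ∈ xs → w ∈ ys → ¬ AtMostOnce (xs ++ ys)
  twice-++ {w} xs {ys} w∈xs w∈ys once =
    <-irrefl refl (≤-trans (+-mono-≤ (count-∈ w∈xs) (count-∈ w∈ys)) (subst (_≤ 1) (count-++ w xs ys) (once w)))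

  atMostOnce-++ˡ : ∀ xs {ys} → AtMostOnce (xs ++ ys) → AtMostOnce xs
  atMostOnce-++ˡ xs {ys} once w = ≤-trans (m≤m+n _ _) (subst (_≤ 1) (count-++ w xs ys) (once w))

  atMostOnce-++ʳ : ∀ xs {ys} → AtMostOnce (xs ++ ys) → AtMostOnce ys
  atMostOnce-++ʳ xs {ys} once w = ≤-trans (m≤n+m _ _) (subst (_≤ 1) (count-++ w xs ys) (once w))

  atMostOnce-∈ : ∀ {s P} → AtMostOnce (concat P) → s ∈ P → AtMostOnce s
  atMostOnce-∈ {s} once (here refl) = atMostOnce-++ˡ s once
  atMostOnce-∈ {P = t ∷ _} once (there s∈) = atMostOnce-∈ (atMostOnce-++ʳ t once) s∈

  precedes-asym : ∀ {s u v} → AtMostOnce s → Precedes s u v → Precedes s v u → ⊥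
  precedes-asym once (at-head u∈) (at-head _) = twice-++ [ _ ] (here refl) u∈ once
  precedes-asym once (at-head _) (in-tail q) = twice-++ [ _ ] (here refl) (precedes-∈ʳ q) once
  precedes-asym once (in-tail p) (at-head _) = twice-++ [ _ ] (here refl) (precedes-∈ʳ p) once
  precedes-asym once (in-tail p) (in-tail q) = precedes-asym (atMostOnce-++ʳ [ _ ] once) p q

  blocks-disjoint : ∀ P {a b u} → AtMostOnce (concat P) → (a , b) ∈ orderedPairs P → u ∈ a → u ∈ b → ⊥
  blocks-disjoint (x ∷ xs) once pair u∈a u∈b with orderedPairs-∷⁻ xs pair
  ... | inj₁ (refl , b∈) = twice-++ x u∈a (∈-concat⁺′ u∈b b∈) once
  ... | inj₂ (inj₁ (refl , a∈)) = twice-++ x u∈b (∈-concat⁺′ u∈a a∈) once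
  ... | inj₂ (inj₂ pair′) = blocks-disjoint xs (atMostOnce-++ʳ x once) pair′ u∈a u∈b

  opposite-precedence : ∀ P {s t u v} → AtMostOnce (concat P) → s ∈ P → t ∈ P →
                        Precedes s u v → Precedes t v u → ⊥
  opposite-precedence P once s∈ t∈ uv vu with orderedPairs⁺ s∈ t∈
  ... | inj₁ refl = precedes-asym (atMostOnce-∈ once s∈) uv vu
  ... | inj₂ pair = blocks-disjoint P once pair (precedes-∈ˡ uv) (precedes-∈ʳ vu)

  separated : ∀ P {a b s u v} → AtMostOnce (concat P) → (a , b) ∈ orderedPairs P →
              u ∈ a → v ∈ b → s ∈ P → u ∈ s → v ∈ s → ⊥
  separated P once pair u∈a v∈b s∈ u∈s v∈s with orderedPairs⁺ (proj₁ (orderedPairs-∈ P pair)) s∈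
  ... | inj₁ refl = blocks-disjoint P once pair v∈s v∈b
  ... | inj₂ pair′ = blocks-disjoint P once pair′ u∈a u∈s

  glue : List A × List A → List A
  glue (a , b) = reverse a ++ reverse b

  complementSequences : List (List A) → List (List A)
  complementSequences P = map glue (orderedPairs P)

  length-complementSequences : ∀ P → length (complementSequences P) ≡ length P * (length P ∸ 1)
  length-complementSequences P = trans (length-map glue (orderedPairs P)) (length-orderedPairs P)

  count-glue : ∀ w p → count w (glue p) ≡ pairWeight (count w) p
  count-glue w (a , b) = trans (count-++ w (reverse a) (reverse b)) (cong₂ _+_ (count-reverse w a) (count-reverse w b))

  count-complementSequences : ∀ w P →
    count w (concat (complementSequences P)) ≡ 2 * (length P ∸ 1) * count w (concat P)
  count-complementSequences w P = begin
    count w (concat (map glue (orderedPairs P)))      ≡⟨ count-concat w (map glue (orderedPairs P)) ⟩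
    sum (map (count w) (map glue (orderedPairs P)))   ≡⟨ cong sum (map-∘ (orderedPairs P)) ⟨
    sum (map (count w ∘ glue) (orderedPairs P))       ≡⟨ cong sum (map-cong (count-glue w) (orderedPairs P)) ⟩
    sum (map (pairWeight (count w)) (orderedPairs P)) ≡⟨ sum-orderedPairs (count w) P ⟩
    2 * (length P ∸ 1) * sum (map (count w) P)        ≡⟨ cong (2 * (length P ∸ 1) *_) (count-concat w P) ⟨
    2 * (length P ∸ 1) * count w (concat P)           ∎
    where open ≡-Reasoning

  -- a block has a partner, so its elements reappear in a glued sequence
  complement-covers : ∀ P {v} → 2 ≤ length P → Covered P v → Covered (complementSequences P) v
  complement-covers P two (s , s∈ , v∈s) with partner s∈ two
  ... | t , pair = glue (s , t) , ∈-map⁺ glue pair , ∈-++⁺ˡ (reverse⁺ v∈s)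

  -- non-arcs of P become arcs: u, v in different blocks are glued in this order,
  -- and v before u inside one block becomes u before v after reversal
  complement-arc-intro : ∀ P {u v} → 2 ≤ length P → Covered P u → Covered P v → u ≢ v →
                         ¬ Arc P u v → Arc (complementSequences P) u v
  complement-arc-intro P two (su , su∈ , u∈) (sv , sv∈ , v∈) u≢v no-arc with orderedPairs⁺ su∈ sv∈
  ... | inj₂ pair = glue (su , sv) , ∈-map⁺ glue pair , precedes-across (reverse⁺ u∈) (reverse⁺ v∈)
  ... | inj₁ refl with precedes-total u∈ v∈ u≢v
  ...   | inj₁ uv = ⊥-elim (no-arc (su , su∈ , uv))
  ...   | inj₂ vu with partner su∈ two
  ...     | t , pair = glue (su , t) , ∈-map⁺ glue pair , precedes-++ˡ (reverse t) (precedes-reverse su vu)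

  -- arcs of the glued sequences are non-arcs of P, by the three ways a
  -- precedence can sit in reverse a ++ reverse b
  complement-arc-elim : ∀ P {u v} → AtMostOnce (concat P) → Arc (complementSequences P) u v → ¬ Arc P u v
  complement-arc-elim P once (_ , glued∈ , uv′) (s , s∈ , uv) with ∈-map⁻ glue glued∈
  ... | (a , b) , pair , refl with precedes-++⁻ (reverse a) uv′
  ...   | inj₁ in-a = opposite-precedence P once s∈ (proj₁ (orderedPairs-∈ P pair)) uv (precedes-reverse⁻ a in-a)
  ...   | inj₂ (inj₂ in-b) = opposite-precedence P once s∈ (proj₂ (orderedPairs-∈ P pair)) uv (precedes-reverse⁻ b in-b)
  ...   | inj₂ (inj₁ (u∈ , v∈)) =
          separated P once pair (reverse⁻ u∈) (reverse⁻ v∈) s∈ (precedes-∈ˡ uv) (precedes-∈ʳ uv)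

module _ {n : ℕ} where
  open Occurrences (_≟ᶠ_ {n})

  precedes⇒occursBefore : ∀ {s} {u v : Fin n} → Precedes s u v → OccursBefore s u v
  precedes⇒occursBefore (at-head v∈) = Fin.zero , Fin.suc (index v∈) , s≤s z≤n , refl , sym (lookup-index v∈)
  precedes⇒occursBefore (in-tail p) with precedes⇒occursBefore p
  ... | i , j , i<j , u≡ , v≡ = Fin.suc i , Fin.suc j , s≤s i<j , u≡ , v≡

  occursBefore⇒precedes : ∀ s {u v : Fin n} → OccursBefore s u v → Precedes s u v
  occursBefore⇒precedes (x ∷ xs) (Fin.zero , Fin.suc j , _ , refl , refl) = at-head (∈-lookup j)
  occursBefore⇒precedes (x ∷ xs) (Fin.suc i , Fin.suc j , s≤s i<j , u≡ , v≡) =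
    in-tail (occursBefore⇒precedes xs (i , j , i<j , u≡ , v≡))

  gArc⇒Arc : ∀ {Q : SeqSet n} {u v} → gArc Q u v → Arc Q u v
  gArc⇒Arc (_ , s , s∈ , occ) = s , s∈ , occursBefore⇒precedes s occ

  Arc⇒gArc : ∀ {Q : SeqSet n} {u v} → u ≢ v → Arc Q u v → gArc Q u v
  Arc⇒gArc u≢v (s , s∈ , p) = u≢v , s , s∈ , precedes⇒occursBefore p

  padding-realises : ∀ (Q : SeqSet n) m {G} → IsSeqDigraph Q G → IsSeqDigraph (Q ++ replicate m []) G
  padding-realises Q m {G} (covers , arcs) = padded-covers , λ u v → mk⇔ (pad ∘ Equivalence.to (arcs u v)) (Equivalence.from (arcs u v) ∘ unpad)
    where
    padded-covers : ∀ v → Covered (Q ++ replicate m []) v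
    padded-covers v = let s , s∈ , v∈s = covers v in s , ∈-++⁺ˡ s∈ , v∈s
    pad : ∀ {u v} → gArc Q u v → gArc (Q ++ replicate m []) u v
    pad (u≢v , s , s∈ , occ) = u≢v , s , ∈-++⁺ˡ s∈ , occ
    unpad : ∀ {u v} → gArc (Q ++ replicate m []) u v → gArc Q u v
    unpad (u≢v , s , s∈ , occ) = u≢v , s , unpad-∈ Q m s∈ (precedes-∈ˡ (occursBefore⇒precedes s occ)) , occ

  complement-realises : ∀ (P : SeqSet n) {G} → AtMostOnce (concat P) → 2 ≤ length P →
                        IsSeqDigraph P G → IsSeqDigraph (complementSequences P) (complement G)
  complement-realises P {G} once two (covers , arcs) =
    (λ v → complement-covers P two (covers v)) , λ u v → mk⇔ (intro u v) (elim u v)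
    where
    intro : ∀ u v → complement G u v → gArc (complementSequences P) u v
    intro u v (u≢v , ¬G) = Arc⇒gArc u≢v
      (complement-arc-intro P two (covers u) (covers v) u≢v (¬G ∘ Equivalence.from (arcs u v) ∘ Arc⇒gArc u≢v))
    elim : ∀ u v → gArc (complementSequences P) u v → complement G u v
    elim u v arc′ = proj₁ arc′ , complement-arc-elim P once (gArc⇒Arc arc′) ∘ gArc⇒Arc ∘ Equivalence.to (arcs u v)

lemma4p54 : (k : ℕ) → 2 ≤ k → (n : ℕ) → (G : Digraph n) →
    InS k 1 G → InS (k * (k ∸ 1)) (2 * (k ∸ 1)) (complement G)
lemma4p54 k 2≤k n G (Q , |Q|≤k , once , realised) =
    complementSequences P
  , ≤-reflexive (trans (length-complementSequences P) (cong (λ m → m * (m ∸ 1)) |P|≡k))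
  , items-bound
  , complement-realises P once-P (subst (2 ≤_) (sym |P|≡k) 2≤k) (padding-realises Q pad realised)
  where
  open Occurrences (_≟ᶠ_ {n})
  pad = k ∸ length Q
  P = Q ++ replicate pad []

  |P|≡k : length P ≡ k
  |P|≡k = length-padding Q |Q|≤k

  once-P : AtMostOnce (concat P)
  once-P v = subst (λ xs → count v xs ≤ 1) (sym (concat-padding Q pad)) (once v)

  items-bound : ∀ v → itemsOfType (complementSequences P) v ≤ 2 * (k ∸ 1)
  items-bound v = begin
    count v (concat (complementSequences P)) ≡⟨ count-complementSequences v P ⟩
    2 * (length P ∸ 1) * count v (concat P)  ≡⟨ cong (λ m → 2 * (m ∸ 1) * count v (concat P)) |P|≡k ⟩
    2 * (k ∸ 1) * count v (concat P)         ≤⟨ *-monoʳ-≤ (2 * (k ∸ 1)) (once-P v) ⟩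
    2 * (k ∸ 1) * 1                          ≡⟨ *-identityʳ (2 * (k ∸ 1)) ⟩
    2 * (k ∸ 1)                              ∎
    where open ≤-Reasoning
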